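{- If a tree $T$ has an edge-partition $E_1,\dots,E_k$ such that for each $i\in[1,k]$ each component of $T-E_i$ has at most $c$ vertices, then $T$ has a consistent $(k+1\!:\!k)$-colouring with clustering $c$.
   Context: A $(p\!:\!q)$-colouring $\alpha$ assigns to each vertex a $q$-subset of a palette of $p$ colours. It is consistent if for each vertex $x$ there is an ordering $\alpha_x^1,\dots,\alpha_x^q$ of $\alpha(x)$ such that $\alpha_x^i\ne\alpha_y^j$ for every edge $xy$ and all distinct $i,j\in[1,q]$. A monochromatic component for colour $\beta$ is a connected component of the subgraph induced by the vertices whose set contains $\beta$; clustering $c$ means every monochromatic component has at most $c$ vertices. -}

module Defs where

open import Data.Nat using (ℕ; suc; _≤_)
open import Data.Fin using (Fin)
open import Data.Fin.Subset using (Subset; _∈_; ∣_∣)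
open import Data.Bool using (Bool; true; false)
open import Data.List using (List; []; _∷_; length)
open import Data.List.Relation.Unary.All using (All)
open import Data.List.Relation.Unary.Unique.Propositional using (Unique)
open import Data.Product using (Σ; ∃; _×_; _,_)
open import Data.Unit using (⊤)
open import Data.Empty using (⊥)
open import Relation.Nullary using (¬_)
open import Relation.Binary.PropositionalEquality using (_≡_; _≢_)
open import Function.Definitions using (Injective)

record Graph (n : ℕ) : Set where
  field
    adj    : Fin n → Fin n → Bool
    sym    : ∀ x y → adj x y ≡ adj y x
    irrefl : ∀ x → adj x x ≡ false

module _ {n : ℕ} (G : Graph n) where
  open Graph G

  Edge : Fin n → Fin n → Set
  Edge x y = adj x y ≡ true

  ConsecAdj : List (Fin n) → Set
  ConsecAdj []            = ⊤
  ConsecAdj (x ∷ [])      = ⊤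
  ConsecAdj (x ∷ y ∷ l)   = Edge x y × ConsecAdj (y ∷ l)

  lastOf : Fin n → List (Fin n) → Fin n
  lastOf x []      = x
  lastOf x (y ∷ l) = lastOf y l

  IsCycle : List (Fin n) → Set
  IsCycle []                = ⊥
  IsCycle (x ∷ [])          = ⊥
  IsCycle (x ∷ y ∷ [])      = ⊥
  IsCycle (x ∷ y ∷ z ∷ l)   =
    Unique (x ∷ y ∷ z ∷ l) × ConsecAdj (x ∷ y ∷ z ∷ l) × Edge (lastOf z l) x

  data Reach (V : Fin n → Set) (E : Fin n → Fin n → Set) : Fin n → Fin n → Set where
    here : ∀ {x} → V x → Reach V E x x
    step : ∀ {x y z} → V x → Edge x y → E x y → Reach V E y z → Reach V E x z

  Connected : Set
  Connected = ∀ x y → Reach (λ _ → ⊤) (λ _ _ → ⊤) x y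

  Acyclic : Set
  Acyclic = ∀ l → ¬ IsCycle l

  IsTree : Set
  IsTree = Connected × Acyclic

  -- every connected component of the subgraph (vertices V, edges of G
  -- satisfying E) has at most c vertices: any list of distinct vertices
  -- lying in the component of v has length ≤ c
  ComponentsAtMost : (V : Fin n → Set) → (E : Fin n → Fin n → Set) → ℕ → Set
  ComponentsAtMost V E c =
    ∀ v → V v → (l : List (Fin n)) → Unique l → All (Reach V E v) l → length l ≤ c

  -- an edge-partition E_1,...,E_k given by a labelling of edges with Fin k
  -- (E_i = edges with label i); the label of an edge is independent of orientation
  EdgePartition : ℕ → Set
  EdgePartition k =
    Σ (Fin n → Fin n → Fin k) λ lab → ∀ x y → Edge x y → lab x y ≡ lab y x

  PQColouring : ℕ → ℕ → Set
  PQColouring p q = Σ (Fin n → Subset p) λ α → ∀ x → ∣ α x ∣ ≡ q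

  -- consistency: orderings α_x^1..α_x^q of α(x) with α_x^i ≠ α_y^j for
  -- every edge xy and distinct i, j
  Consistent : ∀ {p q} → (Fin n → Subset p) → Set
  Consistent {p} {q} α =
    Σ (Fin n → Fin q → Fin p) λ ord →
      (∀ x → Injective _≡_ _≡_ (ord x)) ×
      (∀ x (β : Fin p) → (β ∈ α x → ∃ λ i → ord x i ≡ β) × (∀ i → ord x i ≡ β → β ∈ α x)) ×
      (∀ x y → Edge x y → ∀ (i j : Fin q) → i ≢ j → ord x i ≢ ord y j)

  Clustering : ∀ {p} → (Fin n → Subset p) → ℕ → Set
  Clustering {p} α c = ∀ (β : Fin p) → ComponentsAtMost (λ x → β ∈ α x) (λ _ _ → ⊤) c

module Submission where

-- Give every vertex x a bijection  frame x  from the slots {0, …, k} to the colours,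
-- slot 0 holding the colour missing at x and slot i+1 the i-th colour of the ordering,
-- such that across an edge of class E_i the frames differ by the swap of slots 0 and i+1.
-- On a tree such frames exist: transport the identity frame from a root along walks.
-- Backtracking cancels because swaps are involutions, so a walk acts like its reduced
-- path, and in an acyclic graph that path is determined by the endpoints.
-- Across an edge of class E_i a colour either keeps its slot or moves between slot i+1
-- and slot 0, which is consistency.  A colour in slot s+1 at x keeps that slot along
-- its monochromatic component, so the component uses no edge of E_s and lies inside a
-- component of T − E_s.

open import Defs
open import Data.Nat using (ℕ; zero; suc; _∸_)
open import Data.Fin using (Fin; zero; suc)
open import Data.Fin.Properties using (_≟_; 0≢1+n; suc-injective)
open import Data.Fin.Subset using (Subset; ∁; ⁅_⁆; ∣_∣; _∈_)
open import Data.Fin.Subset.Properties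
  using (x∈∁p⇒x∉p; x∉p⇒x∈∁p; x∈⁅x⁆; x∈⁅y⁆⇒x≡y; ∣∁p∣≡n∸∣p∣; ∣⁅x⁆∣≡1)
open import Data.Product using (Σ; ∃; Σ-syntax; _×_; _,_; proj₁; proj₂)
open import Data.Unit using (⊤; tt)
open import Data.Empty using (⊥-elim)
open import Data.List using (List; []; _∷_; _∷ʳ_)
open import Data.List.Relation.Unary.All as All using (All; []; _∷_)
open import Data.List.Relation.Unary.All.Properties using (¬Any⇒All¬)
open import Data.List.Relation.Unary.Any using (here; there)
open import Data.List.Relation.Unary.AllPairs using ([]; _∷_)
open import Data.List.Relation.Unary.Unique.Propositional using (Unique)
open import Data.List.Membership.Propositional using () renaming (_∈_ to _∈ₗ_)
open import Relation.Nullary using (¬_; yes; no)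
open import Relation.Binary.PropositionalEquality

swap₀ : ∀ {k} → Fin k → Fin (suc k) → Fin (suc k)
swap₀ i zero = suc i
swap₀ i (suc j) with j ≟ i
... | yes _ = zero
... | no _  = suc j

swap₀-suc-self : ∀ {k} (i : Fin k) → swap₀ i (suc i) ≡ zero
swap₀-suc-self i with i ≟ i
... | yes _ = refl
... | no i≢i = ⊥-elim (i≢i refl)

swap₀-suc-other : ∀ {k} {i j : Fin k} → j ≢ i → swap₀ i (suc j) ≡ suc j
swap₀-suc-other {i = i} {j} j≢i with j ≟ i
... | yes j≡i = ⊥-elim (j≢i j≡i)
... | no _    = refl

swap₀-involutive : ∀ {k} (i : Fin k) (t : Fin (suc k)) → swap₀ i (swap₀ i t) ≡ t
swap₀-involutive i zero = swap₀-suc-self i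
swap₀-involutive i (suc j) with j ≟ i
... | yes refl = refl
... | no j≢i   = swap₀-suc-other j≢i

swap₀-suc-≢ : ∀ {k} (i : Fin k) {j l : Fin k} → j ≢ l → swap₀ i (suc l) ≢ suc j
swap₀-suc-≢ i {l = l} j≢l with l ≟ i
... | yes _ = 0≢1+n
... | no _  = λ sl≡sj → j≢l (sym (suc-injective sl≡sj))

module _ {n : ℕ} (G : Graph n) where

  edge-sym : ∀ {x y} → Edge G x y → Edge G y x
  edge-sym {x} {y} e = trans (Graph.sym G y x) e

  edge-irrefl : ∀ {x y} → Edge G x y → y ≢ x
  edge-irrefl {x} e refl with trans (sym e) (Graph.irrefl G x)
  ... | ()

  IsPath : List (Fin n) → Set
  IsPath l = Unique l × ConsecAdj G l

  reach-head : ∀ {V E a b} → Reach G V E a b → V a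
  reach-head (here v)       = v
  reach-head (step v _ _ _) = v

  reach⇒walk : ∀ {V E a b} → Reach G V E a b →
               Σ[ l ∈ List (Fin n) ] ConsecAdj G (a ∷ l) × lastOf G a l ≡ b
  reach⇒walk (here _) = [] , tt , refl
  reach⇒walk (step {y = y} _ e _ r) with reach⇒walk r
  ... | l , w , end = y ∷ l , (e , w) , end

  All-lastOf : ∀ {Q : Fin n → Set} a l → All Q (a ∷ l) → Q (lastOf G a l)
  All-lastOf a []      (q ∷ []) = q
  All-lastOf a (b ∷ l) (_ ∷ qs) = All-lastOf b l qs

  lastOf-∷ʳ : ∀ a l y → lastOf G a (l ∷ʳ y) ≡ y
  lastOf-∷ʳ a []      y = refl
  lastOf-∷ʳ a (b ∷ l) y = lastOf-∷ʳ b l y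

  ConsecAdj-∷ʳ : ∀ a l y → ConsecAdj G (a ∷ l) → Edge G (lastOf G a l) y →
                 ConsecAdj G (a ∷ (l ∷ʳ y))
  ConsecAdj-∷ʳ a []      y _       e = e , tt
  ConsecAdj-∷ʳ a (b ∷ l) y (e′ , w) e = e′ , ConsecAdj-∷ʳ b l y w e

  closedPath : ∀ {a l} → IsPath (a ∷ l) → lastOf G a l ≡ a → l ≡ []
  closedPath {l = []}    _              _   = refl
  closedPath {l = b ∷ l} (a∉ ∷ _ , _) end = ⊥-elim (All-lastOf b l a∉ (sym end))

  prefixTo : ∀ {y l} → y ∈ₗ l → List (Fin n)
  prefixTo {y} (here _)          = y ∷ []
  prefixTo     (there {x = x} p) = x ∷ prefixTo p

  All-prefixTo : ∀ {Q : Fin n → Set} {y l} → All Q l → (p : y ∈ₗ l) → All Q (prefixTo p)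
  All-prefixTo (q ∷ _)  (here refl) = q ∷ []
  All-prefixTo (q ∷ qs) (there p)   = q ∷ All-prefixTo qs p

  Unique-prefixTo : ∀ {y l} → Unique l → (p : y ∈ₗ l) → Unique (prefixTo p)
  Unique-prefixTo (_ ∷ _)   (here refl) = [] ∷ []
  Unique-prefixTo (x∉ ∷ u) (there p)   = All-prefixTo x∉ p ∷ Unique-prefixTo u p

  ConsecAdj-prefixTo : ∀ {y l} a → ConsecAdj G (a ∷ l) → (p : y ∈ₗ l) →
                       ConsecAdj G (a ∷ prefixTo p)
  ConsecAdj-prefixTo a (e , _) (here refl)       = e , tt
  ConsecAdj-prefixTo a (e , w) (there {x = x} p) = e , ConsecAdj-prefixTo x w p

  IsPath-prefixTo : ∀ {y l} a → IsPath (a ∷ l) → (p : y ∈ₗ l) → IsPath (a ∷ prefixTo p)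
  IsPath-prefixTo a (a∉ ∷ u , w) p =
    All-prefixTo a∉ p ∷ Unique-prefixTo u p , ConsecAdj-prefixTo a w p

  lastOf-prefixTo : ∀ {y l} a (p : y ∈ₗ l) → lastOf G a (prefixTo p) ≡ y
  lastOf-prefixTo a (here _)          = refl
  lastOf-prefixTo a (there {x = x} p) = lastOf-prefixTo x p

  acyclic⇒noChord : Acyclic G → ∀ {h x y rest} → IsPath (h ∷ x ∷ rest) → y ∈ₗ rest →
                    ¬ Edge G y h
  acyclic⇒noChord acyclic {h} {x} {y} path p e =
    acyclic (h ∷ x ∷ prefixTo p) (closeUp p (IsPath-prefixTo h path (there p)))
    where
    closeUp : ∀ {rest} (q : y ∈ₗ rest) → IsPath (h ∷ x ∷ prefixTo q) →
              IsCycle G (h ∷ x ∷ prefixTo q)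
    closeUp (here refl)       (u , w) = u , w , e
    closeUp (there {x = z} q) (u , w) =
      u , w , subst (λ v → Edge G v h) (sym (lastOf-prefixTo z q)) e

-- g x y translates data seen from y into data seen from x; going there and back is the
-- identity, so on a tree the composite of g along a walk depends only on its endpoints.
module Holonomy {n : ℕ} (G : Graph n) (acyclic : Acyclic G) {A : Set}
                (g : Fin n → Fin n → A → A)
                (g-involutive : ∀ {x y} → Edge G x y → ∀ t → g y x (g x y t) ≡ t) where

  open import Data.List.Membership.DecPropositional (_≟_ {n}) using (_∈?_)

  hol : Fin n → List (Fin n) → A → A
  hol a []      t = t
  hol a (b ∷ l) t = g a b (hol b l t)

  hol⁻¹ : Fin n → List (Fin n) → A → A
  hol⁻¹ a []      t = t
  hol⁻¹ a (b ∷ l) t = hol⁻¹ b l (g b a t)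

  hol⁻¹-hol : ∀ a l → ConsecAdj G (a ∷ l) → ∀ t → hol⁻¹ a l (hol a l t) ≡ t
  hol⁻¹-hol a []      _       t = refl
  hol⁻¹-hol a (b ∷ l) (e , w) t =
    trans (cong (hol⁻¹ b l) (g-involutive e (hol b l t))) (hol⁻¹-hol b l w t)

  hol-hol⁻¹ : ∀ a l → ConsecAdj G (a ∷ l) → ∀ t → hol a l (hol⁻¹ a l t) ≡ t
  hol-hol⁻¹ a []      _       t = refl
  hol-hol⁻¹ a (b ∷ l) (e , w) t =
    trans (cong (g a b) (hol-hol⁻¹ b l w (g b a t))) (g-involutive (edge-sym G e) t)

  hol-∷ʳ : ∀ a l y t → hol a (l ∷ʳ y) t ≡ hol a l (g (lastOf G a l) y t)
  hol-∷ʳ a []      y t = refl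
  hol-∷ʳ a (b ∷ l) y t = cong (g a b) (hol-∷ʳ b l y t)

  -- A path from z to the base of the path h ∷ rest whose reversed holonomy is that of
  -- h ∷ rest precomposed with f: the reduced form of "h ∷ rest, then a walk acting by f".
  Restack : Fin n → List (Fin n) → Fin n → (A → A) → Set
  Restack h rest z f = Σ[ s ∈ List (Fin n) ]
    IsPath G (z ∷ s) × lastOf G z s ≡ lastOf G h rest × (∀ t → hol⁻¹ z s t ≡ hol⁻¹ h rest (f t))

  restack-edge : ∀ {h rest y} → IsPath G (h ∷ rest) → Edge G h y → Restack h rest y (g h y)
  restack-edge {h} {[]} p e = h ∷ [] , ((edge-irrefl G e ∷ []) ∷ [] ∷ [] , edge-sym G e , tt) ,
                                  refl , λ _ → refl
  restack-edge {h} {x ∷ rest} {y} p@(h∉ ∷ x∉ ∷ u , _ , w) e with y ≟ x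
  ... | yes refl = rest , (x∉ ∷ u , w) , refl , λ t → cong (hol⁻¹ x rest) (sym (g-involutive e t))
  ... | no y≢x with y ∈? rest
  ...   | yes y∈rest = ⊥-elim (acyclic⇒noChord G acyclic p y∈rest (edge-sym G e))
  ...   | no y∉rest  = h ∷ x ∷ rest ,
                       (((edge-irrefl G e ∷ y≢x ∷ ¬Any⇒All¬ rest y∉rest) ∷ h∉ ∷ x∉ ∷ u) ,
                        edge-sym G e , proj₂ p) ,
                       refl , λ _ → refl

  restack-walk : ∀ {h rest} l → IsPath G (h ∷ rest) → ConsecAdj G (h ∷ l) →
                 Restack h rest (lastOf G h l) (hol h l)
  restack-walk {rest = rest} [] p _ = rest , p , refl , λ _ → refl
  restack-walk (y ∷ l) p (e , w) with restack-edge p e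
  ... | s₁ , p₁ , base₁ , hol₁ with restack-walk l p₁ w
  ...   | s₂ , p₂ , base₂ , hol₂ =
    s₂ , p₂ , trans base₂ base₁ , λ t → trans (hol₂ t) (hol₁ (hol y l t))

  paths-agree : ∀ {z s₁ s₂} → IsPath G (z ∷ s₁) → IsPath G (z ∷ s₂) →
                lastOf G z s₁ ≡ lastOf G z s₂ → ∀ t → hol⁻¹ z s₁ t ≡ hol⁻¹ z s₂ t
  paths-agree {z} {s₁} {s₂} p₁ p₂ same-base t
    with restack-walk s₂ p₁ (proj₂ p₂)
  ... | s , p , base , hol≡ with closedPath G p (trans base same-base)
  ...   | refl = begin
    hol⁻¹ z s₁ t                         ≡⟨ cong (hol⁻¹ z s₁) (hol-hol⁻¹ z s₂ (proj₂ p₂) t) ⟨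
    hol⁻¹ z s₁ (hol z s₂ (hol⁻¹ z s₂ t)) ≡⟨ hol≡ (hol⁻¹ z s₂ t) ⟨
    hol⁻¹ z s₂ t                         ∎
    where open ≡-Reasoning

  hol-endpoints : ∀ a l₁ l₂ → ConsecAdj G (a ∷ l₁) → ConsecAdj G (a ∷ l₂) →
                  lastOf G a l₁ ≡ lastOf G a l₂ → ∀ t → hol a l₁ t ≡ hol a l₂ t
  hol-endpoints a l₁ l₂ w₁ w₂ same-end t =
    agree same-end (restack-walk l₁ start w₁) (restack-walk l₂ start w₂)
    where
    start : IsPath G (a ∷ [])
    start = [] ∷ [] , tt
    agree : ∀ {z₁ z₂} → z₁ ≡ z₂ → Restack a [] z₁ (hol a l₁) → Restack a [] z₂ (hol a l₂) →
            hol a l₁ t ≡ hol a l₂ t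
    agree refl (_ , p₁ , base₁ , hol₁) (_ , p₂ , base₂ , hol₂) =
      trans (sym (hol₁ t)) (trans (paths-agree p₁ p₂ (trans base₁ (sym base₂)) t) (hol₂ t))

  module Frames (connected : Connected G) (root : Fin n) where

    walkTo : ∀ x → Σ[ l ∈ List (Fin n) ] ConsecAdj G (root ∷ l) × lastOf G root l ≡ x
    walkTo x = reach⇒walk G (connected root x)

    frame : Fin n → A → A
    frame x = hol root (proj₁ (walkTo x))

    frame⁻¹ : Fin n → A → A
    frame⁻¹ x = hol⁻¹ root (proj₁ (walkTo x))

    frame-frame⁻¹ : ∀ x t → frame x (frame⁻¹ x t) ≡ t
    frame-frame⁻¹ x = hol-hol⁻¹ root _ (proj₁ (proj₂ (walkTo x)))

    frame-injective : ∀ x {t u} → frame x t ≡ frame x u → t ≡ u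
    frame-injective x {t} {u} eq = begin
      t                      ≡⟨ hol⁻¹-hol root _ (proj₁ (proj₂ (walkTo x))) t ⟨
      frame⁻¹ x (frame x t)  ≡⟨ cong (frame⁻¹ x) eq ⟩
      frame⁻¹ x (frame x u)  ≡⟨ hol⁻¹-hol root _ (proj₁ (proj₂ (walkTo x))) u ⟩
      u                      ∎
      where open ≡-Reasoning

    frame-edge : ∀ {x y} → Edge G x y → ∀ t → frame y t ≡ frame x (g x y t)
    frame-edge {x} {y} e t with walkTo x | walkTo y
    ... | lx , wx , endx | ly , wy , endy = begin
      hol root ly t                            ≡⟨ hol-endpoints root ly (lx ∷ʳ y) wy wx+e
                                                    (trans endy (sym (lastOf-∷ʳ G root lx y))) t ⟩
      hol root (lx ∷ʳ y) t                     ≡⟨ hol-∷ʳ root lx y t ⟩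
      hol root lx (g (lastOf G root lx) y t)   ≡⟨ cong (λ v → hol root lx (g v y t)) endx ⟩
      hol root lx (g x y t)                    ∎
      where
      open ≡-Reasoning
      wx+e : ConsecAdj G (root ∷ (lx ∷ʳ y))
      wx+e = ConsecAdj-∷ʳ G root lx y wx (subst (λ v → Edge G v y) (sym endx) e)

module SwapFrames {n : ℕ} (T : Graph n) (tree : IsTree T) {k : ℕ} (P : EdgePartition T k)
                  (root : Fin n) where

  lab : Fin n → Fin n → Fin k
  lab = proj₁ P

  swap-involutive : ∀ {x y} → Edge T x y → ∀ t → swap₀ (lab y x) (swap₀ (lab x y) t) ≡ t
  swap-involutive {x} {y} e t =
    trans (cong (λ i → swap₀ i (swap₀ (lab x y) t)) (sym (proj₂ P x y e))) (swap₀-involutive _ t)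

  open Holonomy T (proj₂ tree) (λ x y → swap₀ (lab x y)) swap-involutive
  open Frames (proj₁ tree) root

  missing : Fin n → Fin (suc k)
  missing x = frame x zero

  colours : Fin n → Subset (suc k)
  colours x = ∁ ⁅ missing x ⁆

  slot : Fin n → Fin k → Fin (suc k)
  slot x i = frame x (suc i)

  ∣colours∣≡k : ∀ x → ∣ colours x ∣ ≡ k
  ∣colours∣≡k x = trans (∣∁p∣≡n∸∣p∣ ⁅ missing x ⁆) (cong (suc k ∸_) (∣⁅x⁆∣≡1 (missing x)))

  ∈colours⇒≢missing : ∀ {x β} → β ∈ colours x → β ≢ missing x
  ∈colours⇒≢missing {x} β∈ refl = x∈∁p⇒x∉p β∈ (x∈⁅x⁆ (missing x))

  slot-injective : ∀ x {i j} → slot x i ≡ slot x j → i ≡ j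
  slot-injective x eq = suc-injective (frame-injective x eq)

  slot-∈colours : ∀ x i → slot x i ∈ colours x
  slot-∈colours x i =
    x∉p⇒x∈∁p (λ ∈⁅missing⁆ → 0≢1+n (sym (frame-injective x (x∈⁅y⁆⇒x≡y _ ∈⁅missing⁆))))

  ∈colours⇒slot : ∀ {x β} → β ∈ colours x → ∃ λ i → slot x i ≡ β
  ∈colours⇒slot {x} {β} β∈ with frame⁻¹ x β in eq
  ... | zero  = ⊥-elim (∈colours⇒≢missing β∈ (trans (sym (frame-frame⁻¹ x β)) (cong (frame x) eq)))
  ... | suc i = i , trans (cong (frame x) (sym eq)) (frame-frame⁻¹ x β)

  slot-edge-≢ : ∀ {x y} → Edge T x y → ∀ {i j} → i ≢ j → slot x i ≢ slot y j
  slot-edge-≢ {x} {y} e {j = j} i≢j eq =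
    swap₀-suc-≢ (lab x y) i≢j (sym (frame-injective x (trans eq (frame-edge e (suc j)))))

  slot-edge-monochromatic : ∀ {x y s β} → Edge T x y → slot x s ≡ β → β ∈ colours y →
                            lab x y ≢ s × slot y s ≡ β
  slot-edge-monochromatic {x} {y} {s} e refl β∈ = lab≢s , slot-kept
    where
    lab≢s : lab x y ≢ s
    lab≢s refl = ∈colours⇒≢missing β∈ (sym (frame-edge e zero))
    slot-kept : slot y s ≡ slot x s
    slot-kept = trans (frame-edge e (suc s))
                      (cong (frame x) (swap₀-suc-other λ s≡lab → lab≢s (sym s≡lab)))

  monochromatic⇒avoids : ∀ {β s x z} → slot x s ≡ β →
                         Reach T (λ w → β ∈ colours w) (λ _ _ → ⊤) x z →
                         Reach T (λ _ → ⊤) (λ a b → lab a b ≢ s) x z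
  monochromatic⇒avoids _   (here _)         = here tt
  monochromatic⇒avoids at (step _ e _ rest) with slot-edge-monochromatic e at (reach-head T rest)
  ... | lab≢s , at′ = step tt e lab≢s (monochromatic⇒avoids at′ rest)

mainTheorem8 : ∀ {n : ℕ} (T : Graph n) → IsTree T → (k c : ℕ) →
    (P : EdgePartition T k) →
    (∀ (i : Fin k) → ComponentsAtMost T (λ _ → ⊤) (λ x y → proj₁ P x y ≢ i) c) →
    Σ (PQColouring T (suc k) k) λ α →
      Consistent T {suc k} {k} (proj₁ α) × Clustering T (proj₁ α) c
mainTheorem8 {zero} T tree k c P _ =
  ((λ ()) , (λ ())) , ((λ ()) , (λ ()) , (λ ()) , (λ ())) , (λ _ ())
mainTheorem8 {suc _} T tree k c P small =
  (colours , ∣colours∣≡k) ,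
  (slot , slot-injective , (λ x β → ∈colours⇒slot , λ { i refl → slot-∈colours x i }) ,
   λ x y e i j → slot-edge-≢ e) ,
  λ β v β∈ l unique reach →
    let (s , at) = ∈colours⇒slot β∈
    in small s v tt l unique (All.map (monochromatic⇒avoids at) reach)
  where open SwapFrames T tree P zero
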